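{- Let $\psi:W\to W$ be defined recursively by $\psi(\varepsilon)=\varepsilon$ for the empty word $\varepsilon$ and, for nonempty $w\in W$, $$\psi(w)=\psi(w\setminus\mathsf{sw}(w))*\delta(\mathsf{sw}(w)),$$ where $*$ is concatenation and, if $c_1<\cdots<c_m$ are the entries of $\mathsf{sw}(w)$ and $d=\mathsf{des}(\mathsf{sw}(w))$, then $\delta(\mathsf{sw}(w))=c_{d+1}c_1c_2\cdots c_dc_{d+2}\cdots c_m$. Then $\psi$ is a well-defined bijection of $W$ such that $\mathsf{des}(w)=\mathsf{lec}(\psi(w))$ for all $w\in W$. Moreover, the restriction of $\psi$ to the symmetric group $\mathcal S_n$ (permutations in one-line notation) is a bijection $\mathcal S_n\to\mathcal S_n$.
   Context: $W$ is the set of all finite words ($\ell\ge0$) of positive integers with pairwise distinct entries. For $u=u_1\cdots u_\ell$, $\mathsf{des}(u)=\#\{j\in[\ell-1]:u_j>u_{j+1}\}$ and $\mathsf{inv}(u)=\#\{(p,q):p<q,\ u_p>u_q\}$. Special wave: let $w=w_1\cdots w_\ell\in W$ be nonempty. If the entries of $w$ are increasing, $\mathsf{sw}(w)=w$ and $w\setminus\mathsf{sw}(w)$ is empty. Otherwise let $t$ be minimal with $w_t>w_{t+1}$; let $r$ be minimal with $1\le r\le t$ and $w_r>w_{t+1}$; set $w_0=0$ and let $s$ be maximal with $t<s\le\ell$ and $w_{t+1}>\cdots>w_s>w_{r-1}$. Then $\mathsf{sw}(w)=w_r\cdots w_s$ and $w\setminus\mathsf{sw}(w)=w_1\cdots w_{r-1}w_{s+1}\cdots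 w_\ell$. Hook factorization: every $w\in W$ decomposes uniquely as $w=\gamma*\alpha_1*\cdots*\alpha_m$ with $\gamma$ a possibly empty increasing word and each $\alpha_j=a_1\cdots a_r$ a hook ($r\ge2$, $a_1>a_2$, $a_2<\cdots<a_r$); $\mathsf{lec}(w)=\sum_j\mathsf{inv}(\alpha_j)$. -}

module Defs where

open import Data.Nat using (ℕ; zero; suc; _+_; _<_; _<ᵇ_; _≤ᵇ_)
open import Data.Nat.Properties using (≤-decTotalOrder)
open import Data.Bool using (Bool; true; false; if_then_else_; _∧_)
open import Data.List using (List; []; _∷_; _++_; length; reverse; take; drop; map)
open import Data.Nat.ListAction using (sum)
open import Data.List.Relation.Unary.All using (All)
open import Data.List.Relation.Unary.Unique.Propositional using (Unique)
open import Data.Product using (_×_; _,_; proj₁; proj₂)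
open import Data.List.Sort.MergeSort ≤-decTotalOrder using (sort)

InW : List ℕ → Set
InW w = All (λ x → 0 < x) w × Unique w

des : List ℕ → ℕ
des [] = 0
des (x ∷ []) = 0
des (x ∷ y ∷ r) = (if y <ᵇ x then 1 else 0) + des (y ∷ r)

countLess : ℕ → List ℕ → ℕ
countLess x [] = 0
countLess x (y ∷ r) = (if y <ᵇ x then 1 else 0) + countLess x r

inv : List ℕ → ℕ
inv [] = 0
inv (x ∷ r) = countLess x r + inv r

incPrefix : List ℕ → List ℕ × List ℕ
incPrefix [] = [] , []
incPrefix (x ∷ []) = x ∷ [] , []
incPrefix (x ∷ y ∷ r) =
  if x <ᵇ y then (x ∷ proj₁ (incPrefix (y ∷ r)) , proj₂ (incPrefix (y ∷ r)))
            else (x ∷ [] , y ∷ r)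

splitLe : ℕ → List ℕ → List ℕ × List ℕ
splitLe b [] = [] , []
splitLe b (x ∷ r) =
  if x ≤ᵇ b then (x ∷ proj₁ (splitLe b r) , proj₂ (splitLe b r))
            else ([] , x ∷ r)

-- last entry of a word, or 0 if empty (convention w_0 = 0)
lastOr0 : List ℕ → ℕ
lastOr0 [] = 0
lastOr0 (x ∷ []) = x
lastOr0 (x ∷ y ∷ r) = lastOr0 (y ∷ r)

decRun : ℕ → ℕ → List ℕ → List ℕ × List ℕ
decRun lo prev [] = [] , []
decRun lo prev (x ∷ r) =
  if (x <ᵇ prev) ∧ (lo <ᵇ x)
    then (x ∷ proj₁ (decRun lo x r) , proj₂ (decRun lo x r))
    else ([] , x ∷ r)

swSplit : List ℕ → List ℕ × List ℕ
swSplit w with incPrefix w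
... | A , [] = A , []
... | A , (b ∷ post) with splitLe b A
...   | A1 , A2 with decRun (lastOr0 A1) b post
...     | D , rest = (A2 ++ (b ∷ D)) , (A1 ++ rest)

sw : List ℕ → List ℕ
sw w = proj₁ (swSplit w)

swRest : List ℕ → List ℕ
swRest w = proj₂ (swSplit w)

δ : List ℕ → List ℕ
δ u with drop (des u) (sort u)
... | [] = sort u
... | x ∷ rest = x ∷ (take (des u) (sort u) ++ rest)

-- ψ: recursion ψ(ε) = ε, ψ(w) = ψ(w \ sw(w)) * δ(sw(w)), run with fuel
-- length w (the recursion is on strictly shorter words).

psiFuel : ℕ → List ℕ → List ℕ
psiFuel zero w = []
psiFuel (suc f) [] = []
psiFuel (suc f) (x ∷ w) = psiFuel f (swRest (x ∷ w)) ++ δ (sw (x ∷ w))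

ψ : List ℕ → List ℕ
ψ w = psiFuel (length w) w

-- Hook factorization w = γ * α_1 * ... * α_m, computed from the right:
-- the last hook is w_{k-1} w_k .. w_ℓ where w_k .. w_ℓ is the maximal
-- increasing suffix (if k > 1); otherwise w = γ.
-- Working on the reversed word: maximal decreasing prefix of reverse w.

decPrefix : List ℕ → List ℕ × List ℕ
decPrefix [] = [] , []
decPrefix (x ∷ []) = x ∷ [] , []
decPrefix (x ∷ y ∷ r) =
  if y <ᵇ x then (x ∷ proj₁ (decPrefix (y ∷ r)) , proj₂ (decPrefix (y ∷ r)))
            else (x ∷ [] , y ∷ r)

-- on a reversed word, with fuel; returns (γ , [α_1 , ... , α_m])
hookRev : ℕ → List ℕ → List ℕ × List (List ℕ)
hookRev zero r = reverse r , []
hookRev (suc f) r with decPrefix r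
... | a , [] = reverse a , []
... | a , (x ∷ rest) with hookRev f rest
...   | γ , αs = γ , (αs ++ ((x ∷ reverse a) ∷ []))

hookFactorization : List ℕ → List ℕ × List (List ℕ)
hookFactorization w = hookRev (length w) (reverse w)

lec : List ℕ → ℕ
lec w = sum (map inv (proj₂ (hookFactorization w)))

-- A word w ∈ W that is not ascending factors as w = A · qQ · bD · R, where qQ is the part of
-- its first ascending run above the first descent bottom b and bD is the descending run that
-- follows, so that sw(w) = qQbD and w ∖ sw(w) = AR. Sorted, sw(w) reads rev(bD) · qQ and it has
-- |D| + 1 descents, hence δ(sw w) = q · rev(bD) · Q is a hook with |D| + 1 inversions. Removing the
-- wave removes exactly |D| + 1 descents of w (the entry after it lies outside the interval between
-- the last entry of A and the bottom of D), and a hook appended to a word is appended to its hook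
-- factorization; so des w = lec(ψ w) by induction on length. Conversely a word ending in a hook
-- q · X · Q (X < q < Q) comes from exactly one wave: bD = rev X, and AR splits back at its maximal
-- ascending prefix below the last entry of D. This inverts ψ step by step, and since ψ only
-- permutes entries it restricts to a bijection of S_n.

module Submission where

open import Defs
open import Data.Nat using (ℕ; zero; suc; _+_; _<_; _≤_; _>_; _<ᵇ_; _≤ᵇ_; z≤n; s≤s; _<?_; _≤?_)
open import Data.Nat.Properties
open import Data.Nat.Solver using (module +-*-Solver)
open import Data.Bool using (true; false; if_then_else_; _∧_)
open import Data.List using (List; []; _∷_; _++_; length; reverse; take; drop; map; [_]; applyUpTo)
open import Data.List.Base using (reverseAcc)
open import Data.List.Properties
  using (++-assoc; length-++; ++-identityʳ; unfold-reverse; reverse-involutive; length-reverse; take++drop≡id;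
         reverse-++; map-++; ++-cancelʳ; ∷ʳ-injective)
open import Data.Nat.ListAction.Properties using (sum-++)
open import Data.List.Relation.Unary.All as All using (All; []; _∷_)
import Data.List.Relation.Unary.All.Properties as All
open import Data.List.Relation.Unary.Linked as Linked using (Linked; []; [-]; _∷_)
open import Data.List.Relation.Unary.Linked.Properties using (Linked⇒All)
open import Data.List.Relation.Binary.Permutation.Propositional
  using (_↭_; ↭-refl; ↭-sym; ↭-trans; ↭-reflexive; ↭⇒↭ₛ; module PermutationReasoning)
open import Data.List.Relation.Binary.Permutation.Propositional.Properties
  using (All-resp-↭; ↭-length; ↭-reverse; shift; shifts; ++-comm; ++⁺; ++⁺ʳ)
open import Data.List.Relation.Unary.Unique.Propositional using (Unique; _∷_)
import Data.List.Relation.Unary.Unique.Propositional.Properties as Unique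
open import Data.List.Relation.Binary.Equality.Propositional using (≋⇒≡)
import Data.List.Relation.Unary.Sorted.TotalOrder.Properties as Sorted
open import Data.List.Sort.Base using (SortingAlgorithm)
import Data.List.Sort.MergeSort.Properties as MergeSort
open import Data.List.Sort.MergeSort ≤-decTotalOrder using (sort)
open import Data.Product using (_×_; _,_; proj₁; proj₂; ∃; ∃₂; map₁)
open import Data.Sum using (_⊎_; inj₁; inj₂)
open import Induction.WellFounded using (Acc; acc)
open import Data.Nat.Induction using (<-wellFounded)
open import Data.Unit using (⊤; tt)
open import Data.Empty using (⊥; ⊥-elim)
open import Function using (flip; _∘_)
open import Relation.Nullary using (¬_; yes; no)
open import Relation.Nullary.Reflects using (ofʸ; ofⁿ; det)
open import Relation.Binary.PropositionalEquality hiding ([_])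
open import Data.List.Relation.Binary.Permutation.Setoid.Properties (setoid ℕ) using (Unique-resp-↭)

open SortingAlgorithm (MergeSort.mergeSort ≤-decTotalOrder) using (sort-↭; sort-↗)
open +-*-Solver using (solve; _:+_; _:=_; con)

module _ {m n : ℕ} where

  <ᵇ-true : m < n → (m <ᵇ n) ≡ true
  <ᵇ-true m<n = det (<ᵇ-reflects-< m n) (ofʸ m<n)

  <ᵇ-false : ¬ m < n → (m <ᵇ n) ≡ false
  <ᵇ-false m≮n = det (<ᵇ-reflects-< m n) (ofⁿ m≮n)

  ≤ᵇ-true : m ≤ n → (m ≤ᵇ n) ≡ true
  ≤ᵇ-true m≤n = det (≤ᵇ-reflects-≤ m n) (ofʸ m≤n)

  ≤ᵇ-false : ¬ m ≤ n → (m ≤ᵇ n) ≡ false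
  ≤ᵇ-false m≰n = det (≤ᵇ-reflects-≤ m n) (ofⁿ m≰n)

Ascending : List ℕ → Set
Ascending = Linked _<_

Descending : List ℕ → Set
Descending = Linked _>_

OnHead : (ℕ → Set) → List ℕ → Set
OnHead P [] = ⊤
OnHead P (y ∷ _) = P y

OnHead-all : ∀ {P xs} → All P xs → OnHead P xs
OnHead-all [] = tt
OnHead-all (p ∷ _) = p

Between : ℕ → ℕ → ℕ → Set
Between lo hi x = lo < x × x < hi

ascending⇒head< : ∀ {x xs} → Ascending (x ∷ xs) → All (x <_) xs
ascending⇒head< [-] = []
ascending⇒head< (x<y ∷ asc) = Linked⇒All <-trans x<y asc

ascending-∷ : ∀ {x xs} → OnHead (x <_) xs → Ascending xs → Ascending (x ∷ xs)
ascending-∷ {xs = []} _ _ = [-]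
ascending-∷ {xs = _ ∷ _} x<y asc = x<y ∷ asc

ascending-++⁺ : ∀ {xs y ys} → Ascending xs → Ascending (y ∷ ys) → lastOr0 xs < y → Ascending (xs ++ y ∷ ys)
ascending-++⁺ {[]} _ asc _ = asc
ascending-++⁺ {x ∷ []} _ asc x<y = x<y ∷ asc
ascending-++⁺ {x ∷ x′ ∷ xs} (x<x′ ∷ asc) asc′ last<y = x<x′ ∷ ascending-++⁺ asc asc′ last<y

ascending-++⁻ˡ : ∀ xs {ys} → Ascending (xs ++ ys) → Ascending xs
ascending-++⁻ˡ [] _ = []
ascending-++⁻ˡ (x ∷ []) _ = [-]
ascending-++⁻ˡ (x ∷ x′ ∷ xs) (x<x′ ∷ asc) = x<x′ ∷ ascending-++⁻ˡ (x′ ∷ xs) asc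

ascending-++⁻ʳ : ∀ xs {ys} → Ascending (xs ++ ys) → Ascending ys
ascending-++⁻ʳ [] asc = asc
ascending-++⁻ʳ (x ∷ xs) asc = ascending-++⁻ʳ xs (Linked.tail asc)

ascending-++⁻-mid : ∀ xs {y ys} → Ascending (xs ++ y ∷ ys) → All (_< y) xs
ascending-++⁻-mid [] _ = []
ascending-++⁻-mid (x ∷ xs) asc =
  All.head (All.++⁻ʳ xs (ascending⇒head< asc)) ∷ ascending-++⁻-mid xs (Linked.tail asc)

ascending-remove : ∀ xs {y ys} → Ascending (xs ++ y ∷ ys) → Ascending (xs ++ ys)
ascending-remove [] asc = Linked.tail asc
ascending-remove (x ∷ []) {ys = []} _ = [-]
ascending-remove (x ∷ []) {ys = z ∷ zs} (x<y ∷ y<z ∷ asc) = <-trans x<y y<z ∷ asc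
ascending-remove (x ∷ x′ ∷ xs) (x<x′ ∷ asc) = x<x′ ∷ ascending-remove (x′ ∷ xs) asc

reverse-linked : ∀ {R : ℕ → ℕ → Set} {xs} → Linked R xs → Linked (flip R) (reverse xs)
reverse-linked {xs = []} _ = []
reverse-linked {xs = x ∷ xs} rs = go x xs [] rs [-]
  where
  go : ∀ {R : ℕ → ℕ → Set} x xs zs → Linked R (x ∷ xs) → Linked (flip R) (x ∷ zs) →
       Linked (flip R) (reverseAcc (x ∷ zs) xs)
  go x [] zs _ rzs = rzs
  go x (y ∷ ys) zs (r ∷ rs) rzs = go y ys (x ∷ zs) rs (r ∷ rzs)

last-all : ∀ {P : ℕ → Set} {x xs} → All P (x ∷ xs) → P (lastOr0 (x ∷ xs))
last-all {xs = []} (p ∷ []) = p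
last-all {xs = y ∷ ys} (_ ∷ ps) = last-all ps

lastOr0-all : ∀ {P : ℕ → Set} {xs} → All P xs → P 0 → P (lastOr0 xs)
lastOr0-all [] p0 = p0
lastOr0-all (p ∷ ps) _ = last-all (p ∷ ps)

lastOr0-++ : ∀ xs y ys → lastOr0 (xs ++ y ∷ ys) ≡ lastOr0 (y ∷ ys)
lastOr0-++ [] y ys = refl
lastOr0-++ (x ∷ []) y ys = refl
lastOr0-++ (x ∷ x′ ∷ xs) y ys = lastOr0-++ (x′ ∷ xs) y ys

lastOr0-0∷ : ∀ xs → lastOr0 (0 ∷ xs) ≡ lastOr0 xs
lastOr0-0∷ [] = refl
lastOr0-0∷ (_ ∷ _) = refl

lastOr0-reverse : ∀ x xs → lastOr0 (reverse (x ∷ xs)) ≡ x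
lastOr0-reverse x xs = trans (cong lastOr0 (unfold-reverse x xs)) (lastOr0-++ (reverse xs) x [])

ascending⇒≤last : ∀ {xs} → Ascending xs → All (_≤ lastOr0 xs) xs
ascending⇒≤last [] = []
ascending⇒≤last [-] = ≤-refl ∷ []
ascending⇒≤last (x<y ∷ asc) with ascending⇒≤last asc
... | y≤last ∷ ≤last = ≤-trans (<⇒≤ x<y) y≤last ∷ y≤last ∷ ≤last

descending⇒last≤ : ∀ {xs} → Descending xs → All (lastOr0 xs ≤_) xs
descending⇒last≤ [] = []
descending⇒last≤ [-] = ≤-refl ∷ []
descending⇒last≤ (x>y ∷ desc) with descending⇒last≤ desc
... | last≤y ∷ last≤ = ≤-trans last≤y (<⇒≤ x>y) ∷ last≤y ∷ last≤

ascending-reverse-++ : ∀ {q Q b D} → b < q → Ascending (q ∷ Q) → Descending (b ∷ D) →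
  Ascending (reverse (b ∷ D) ++ q ∷ Q)
ascending-reverse-++ {q} {Q} {b} {D} b<q asc desc =
  ascending-++⁺ (reverse-linked desc) asc (subst (_< q) (sym (lastOr0-reverse b D)) b<q)

sort-ascending : ∀ {u c} → u ↭ c → Ascending c → sort u ≡ c
sort-ascending {u} u↭c asc =
  ≋⇒≡ (Sorted.↗↭↗⇒≋ ≤-totalOrder (sort-↗ u) (Linked.map <⇒≤ asc)
                                    (↭⇒↭ₛ (↭-trans (sort-↭ u) u↭c)))

++-∷≢[] : ∀ (xs : List ℕ) {y ys} → xs ++ y ∷ ys ≢ []
++-∷≢[] [] ()
++-∷≢[] (_ ∷ _) ()

length-<-++-∷ : ∀ (xs : List ℕ) {y ys} → length xs < length (xs ++ y ∷ ys)
length-<-++-∷ [] = s≤s z≤n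
length-<-++-∷ (_ ∷ xs) = s≤s (length-<-++-∷ xs)

unique-resp-↭ : ∀ {xs ys : List ℕ} → xs ↭ ys → Unique xs → Unique ys
unique-resp-↭ xs↭ys = Unique-resp-↭ (↭⇒↭ₛ xs↭ys)

unique-++⁻ʳ : ∀ xs {ys : List ℕ} → Unique (xs ++ ys) → Unique ys
unique-++⁻ʳ [] uniq = uniq
unique-++⁻ʳ (x ∷ xs) (_ ∷ uniq) = unique-++⁻ʳ xs uniq

unique-mid : ∀ xs {y : ℕ} {ys} → Unique (xs ++ y ∷ ys) → All (y ≢_) (xs ++ ys)
unique-mid xs {y} {ys} uniq with unique-resp-↭ (shift y xs ys) uniq
... | y∉ ∷ _ = y∉

InW-resp-↭ : ∀ {xs ys} → xs ↭ ys → InW xs → InW ys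
InW-resp-↭ xs↭ys (pos , uniq) = All-resp-↭ xs↭ys pos , unique-resp-↭ xs↭ys uniq

InW-++⁻ʳ : ∀ xs {ys} → InW (xs ++ ys) → InW ys
InW-++⁻ʳ xs (pos , uniq) = All.++⁻ʳ xs pos , unique-++⁻ʳ xs uniq

InW-++⁻ˡ : ∀ xs {ys} → InW (xs ++ ys) → InW xs
InW-++⁻ˡ xs {ys} w = InW-++⁻ʳ ys (InW-resp-↭ (++-comm xs ys) w)

-- Since lastOr0 [] = 0, this vanishes when xs is empty.
junctionDes : List ℕ → List ℕ → ℕ
junctionDes xs [] = 0
junctionDes xs (y ∷ _) = if y <ᵇ lastOr0 xs then 1 else 0

des-++ : ∀ xs ys → des (xs ++ ys) ≡ des xs + junctionDes xs ys + des ys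
des-++ [] [] = refl
des-++ [] (y ∷ ys) = refl
des-++ (x ∷ []) [] = refl
des-++ (x ∷ []) (y ∷ ys) = refl
des-++ (x ∷ x′ ∷ xs) ys = begin
  [x′<x] + des ((x′ ∷ xs) ++ ys)
    ≡⟨ cong ([x′<x] +_) (des-++ (x′ ∷ xs) ys) ⟩
  [x′<x] + (des (x′ ∷ xs) + junctionDes (x′ ∷ xs) ys + des ys)
    ≡⟨ cong (λ j → [x′<x] + (des (x′ ∷ xs) + j + des ys)) (junction-cons ys) ⟩
  [x′<x] + (des (x′ ∷ xs) + junctionDes (x ∷ x′ ∷ xs) ys + des ys)
    ≡⟨ solve 4 (λ a b c d → a :+ (b :+ c :+ d) := a :+ b :+ c :+ d) refl [x′<x] (des (x′ ∷ xs)) _ (des ys) ⟩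
  [x′<x] + des (x′ ∷ xs) + junctionDes (x ∷ x′ ∷ xs) ys + des ys ∎
  where
  open ≡-Reasoning
  [x′<x] : ℕ
  [x′<x] = if x′ <ᵇ x then 1 else 0
  junction-cons : ∀ ys → junctionDes (x′ ∷ xs) ys ≡ junctionDes (x ∷ x′ ∷ xs) ys
  junction-cons [] = refl
  junction-cons (_ ∷ _) = refl

junctionDes-outside : ∀ {xs ys} R → lastOr0 xs < lastOr0 ys →
  OnHead (¬_ ∘ Between (lastOr0 xs) (lastOr0 ys)) R → OnHead (_≢ lastOr0 xs) R →
  junctionDes ys R ≡ junctionDes xs R
junctionDes-outside [] _ _ _ = refl
junctionDes-outside {xs} {ys} (r ∷ _) xs<ys r∉ r≢xs with r <? lastOr0 ys
... | yes r<ys rewrite <ᵇ-true r<ys | <ᵇ-true (≤∧≢⇒< (≮⇒≥ (λ xs<r → r∉ (xs<r , r<ys))) r≢xs) = refl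
... | no r≮ys rewrite <ᵇ-false r≮ys | <ᵇ-false (<⇒≯ (<-≤-trans xs<ys (≮⇒≥ r≮ys))) = refl

des-ascending : ∀ {w} → Ascending w → des w ≡ 0
des-ascending [] = refl
des-ascending [-] = refl
des-ascending {x ∷ y ∷ _} (x<y ∷ asc) rewrite <ᵇ-false (<⇒≯ x<y) = des-ascending asc

des-descending : ∀ {x xs} → Descending (x ∷ xs) → des (x ∷ xs) ≡ length xs
des-descending [-] = refl
des-descending (x>y ∷ desc) rewrite <ᵇ-true x>y = cong suc (des-descending desc)

des-wave : ∀ {q Q b D} → b < q → Ascending (q ∷ Q) → Descending (b ∷ D) →
  des ((q ∷ Q) ++ b ∷ D) ≡ suc (length D)
des-wave {q} {Q} {b} {D} b<q asc desc = begin
  des ((q ∷ Q) ++ b ∷ D)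
    ≡⟨ des-++ (q ∷ Q) (b ∷ D) ⟩
  des (q ∷ Q) + junctionDes (q ∷ Q) (b ∷ D) + des (b ∷ D)
    ≡⟨ cong₂ (λ m n → m + junctionDes (q ∷ Q) (b ∷ D) + n) (des-ascending asc) (des-descending desc) ⟩
  junctionDes (q ∷ Q) (b ∷ D) + length D
    ≡⟨ cong (λ c → (if c then 1 else 0) + length D) (<ᵇ-true b<last) ⟩
  suc (length D) ∎
  where
  open ≡-Reasoning
  b<last : b < lastOr0 (q ∷ Q)
  b<last = <-≤-trans b<q (All.head (ascending⇒≤last asc))

countLess-++ : ∀ x xs ys → countLess x (xs ++ ys) ≡ countLess x xs + countLess x ys
countLess-++ x [] ys = refl
countLess-++ x (y ∷ xs) ys = trans (cong (_ +_) (countLess-++ x xs ys)) (sym (+-assoc (if y <ᵇ x then 1 else 0) _ _))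

countLess-below : ∀ {x xs} → All (_< x) xs → countLess x xs ≡ length xs
countLess-below [] = refl
countLess-below (y<x ∷ ys<x) rewrite <ᵇ-true y<x = cong suc (countLess-below ys<x)

countLess-above : ∀ {x xs} → All (x <_) xs → countLess x xs ≡ 0
countLess-above [] = refl
countLess-above (x<y ∷ x<ys) rewrite <ᵇ-false (<⇒≯ x<y) = countLess-above x<ys

inv-ascending : ∀ {w} → Ascending w → inv w ≡ 0
inv-ascending [] = refl
inv-ascending {x ∷ _} asc rewrite countLess-above (ascending⇒head< asc) = inv-ascending (Linked.tail asc)

joined : List ℕ × List ℕ → List ℕ
joined (xs , ys) = xs ++ ys

joined-≡ : ∀ {p : List ℕ × List ℕ} {w xs ys} → joined p ≡ w → p ≡ (xs , ys) → xs ++ ys ≡ w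
joined-≡ joined≡w refl = joined≡w

incPrefix-joined : ∀ w → joined (incPrefix w) ≡ w
incPrefix-joined [] = refl
incPrefix-joined (x ∷ []) = refl
incPrefix-joined (x ∷ y ∷ r) with x <ᵇ y | incPrefix-joined (y ∷ r)
... | true | ih = cong (x ∷_) ih
... | false | _ = refl

incPrefix-head : ∀ x r → ∃ λ A → proj₁ (incPrefix (x ∷ r)) ≡ x ∷ A
incPrefix-head x [] = [] , refl
incPrefix-head x (y ∷ r) with x <? y
... | yes x<y rewrite <ᵇ-true x<y = proj₁ (incPrefix (y ∷ r)) , refl
... | no x≮y rewrite <ᵇ-false x≮y = [] , refl

IsIncPrefix : List ℕ × List ℕ → Set
IsIncPrefix (A , R) = Ascending A × OnHead (λ y → ¬ lastOr0 A < y) R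

incPrefix-isIncPrefix : ∀ w → IsIncPrefix (incPrefix w)
incPrefix-isIncPrefix [] = [] , tt
incPrefix-isIncPrefix (x ∷ []) = [-] , tt
incPrefix-isIncPrefix (x ∷ y ∷ r) with x <? y | incPrefix-isIncPrefix (y ∷ r)
... | no x≮y | _ rewrite <ᵇ-false x≮y = [-] , x≮y
... | yes x<y | ih rewrite <ᵇ-true x<y
  with proj₁ (incPrefix (y ∷ r)) | incPrefix-head y r | ih
...   | .(y ∷ A) | A , refl | asc , stop = x<y ∷ asc , stop

incPrefix-++ : ∀ {A} ys → Ascending A → A ≢ [] → OnHead (λ y → ¬ lastOr0 A < y) ys →
  incPrefix (A ++ ys) ≡ (A , ys)
incPrefix-++ {[]} _ _ A≢[] _ = ⊥-elim (A≢[] refl)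
incPrefix-++ {x ∷ []} [] _ _ _ = refl
incPrefix-++ {x ∷ []} (y ∷ ys) _ _ x≮y rewrite <ᵇ-false x≮y = refl
incPrefix-++ {x ∷ x′ ∷ A} ys (x<x′ ∷ asc) _ stop rewrite <ᵇ-true x<x′ | incPrefix-++ ys asc (λ ()) stop = refl

splitLe-joined : ∀ b w → joined (splitLe b w) ≡ w
splitLe-joined b [] = refl
splitLe-joined b (x ∷ r) with x ≤ᵇ b
... | true = cong (x ∷_) (splitLe-joined b r)
... | false = refl

IsSplitLe : ℕ → List ℕ × List ℕ → Set
IsSplitLe b (xs , ys) = All (_≤ b) xs × OnHead (b <_) ys

splitLe-isSplitLe : ∀ b w → IsSplitLe b (splitLe b w)
splitLe-isSplitLe b [] = [] , tt
splitLe-isSplitLe b (x ∷ r) with x ≤? b | splitLe-isSplitLe b r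
... | yes x≤b | ih rewrite ≤ᵇ-true x≤b = map₁ (x≤b ∷_) ih
... | no x≰b | _ rewrite ≤ᵇ-false x≰b = [] , ≰⇒> x≰b

splitLe-++ : ∀ {b} xs ys → IsSplitLe b (xs , ys) → splitLe b (xs ++ ys) ≡ (xs , ys)
splitLe-++ [] [] _ = refl
splitLe-++ [] (y ∷ ys) (_ , b<y) rewrite ≤ᵇ-false (<⇒≱ b<y) = refl
splitLe-++ (x ∷ xs) ys (x≤b ∷ xs≤b , stop) rewrite ≤ᵇ-true x≤b | splitLe-++ xs ys (xs≤b , stop) = refl

decRun-joined : ∀ lo p w → joined (decRun lo p w) ≡ w
decRun-joined lo p [] = refl
decRun-joined lo p (x ∷ r) with (x <ᵇ p) ∧ (lo <ᵇ x)
... | true = cong (x ∷_) (decRun-joined lo x r)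
... | false = refl

IsDecRun : ℕ → ℕ → List ℕ × List ℕ → Set
IsDecRun lo p (D , R) = Descending (p ∷ D) × All (lo <_) D × OnHead (¬_ ∘ Between lo (lastOr0 (p ∷ D))) R

decRun-isDecRun : ∀ lo p w → IsDecRun lo p (decRun lo p w)
decRun-isDecRun lo p [] = [-] , [] , tt
decRun-isDecRun lo p (x ∷ r) with x <? p | lo <? x | decRun-isDecRun lo x r
... | yes x<p | yes lo<x | desc , lo< , stop rewrite <ᵇ-true x<p | <ᵇ-true lo<x = x<p ∷ desc , lo<x ∷ lo< , stop
decRun-isDecRun lo p (x ∷ r) | yes x<p | no lo≮x | _ rewrite <ᵇ-true x<p | <ᵇ-false lo≮x =
  [-] , [] , lo≮x ∘ proj₁
decRun-isDecRun lo p (x ∷ r) | no x≮p | _ | _ rewrite <ᵇ-false x≮p = [-] , [] , x≮p ∘ proj₂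

decRun-++ : ∀ {lo p} D R → IsDecRun lo p (D , R) → decRun lo p (D ++ R) ≡ (D , R)
decRun-++ {lo} {p} [] [] _ = refl
decRun-++ {lo} {p} [] (r ∷ R) (_ , _ , stop) with r <? p
... | yes r<p rewrite <ᵇ-true r<p | <ᵇ-false (λ lo<r → stop (lo<r , r<p)) = refl
... | no r≮p rewrite <ᵇ-false r≮p = refl
decRun-++ (x ∷ D) R (x<p ∷ desc , lo<x ∷ lo< , stop)
  rewrite <ᵇ-true x<p | <ᵇ-true lo<x | decRun-++ D R (desc , lo< , stop) = refl

decPrefix-joined : ∀ w → joined (decPrefix w) ≡ w
decPrefix-joined [] = refl
decPrefix-joined (x ∷ []) = refl
decPrefix-joined (x ∷ y ∷ r) with y <ᵇ x | decPrefix-joined (y ∷ r)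
... | true | ih = cong (x ∷_) ih
... | false | _ = refl

decPrefix-++ : ∀ {D} ys → Descending D → D ≢ [] → OnHead (λ y → ¬ y < lastOr0 D) ys →
  decPrefix (D ++ ys) ≡ (D , ys)
decPrefix-++ {[]} _ _ D≢[] _ = ⊥-elim (D≢[] refl)
decPrefix-++ {x ∷ []} [] _ _ _ = refl
decPrefix-++ {x ∷ []} (y ∷ ys) _ _ y≮x rewrite <ᵇ-false y≮x = refl
decPrefix-++ {x ∷ x′ ∷ D} ys (x>x′ ∷ desc) _ stop
  rewrite <ᵇ-true x>x′ | decPrefix-++ ys desc (λ ()) stop = refl

decPrefix-descending : ∀ {D} → Descending D → decPrefix D ≡ (D , [])
decPrefix-descending [] = refl
decPrefix-descending [-] = refl
decPrefix-descending (x>y ∷ desc) rewrite <ᵇ-true x>y | decPrefix-descending desc = refl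

ascentBelow : ℕ → ℕ → List ℕ → List ℕ × List ℕ
ascentBelow c p [] = [] , []
ascentBelow c p (x ∷ r) =
  if (p <ᵇ x) ∧ (x <ᵇ c)
    then (x ∷ proj₁ (ascentBelow c x r) , proj₂ (ascentBelow c x r))
    else ([] , x ∷ r)

ascentBelow-joined : ∀ c p w → joined (ascentBelow c p w) ≡ w
ascentBelow-joined c p [] = refl
ascentBelow-joined c p (x ∷ r) with (p <ᵇ x) ∧ (x <ᵇ c)
... | true = cong (x ∷_) (ascentBelow-joined c x r)
... | false = refl

IsAscentBelow : ℕ → ℕ → List ℕ × List ℕ → Set
IsAscentBelow c p (A , R) = Ascending (p ∷ A) × All (_< c) A × OnHead (¬_ ∘ Between (lastOr0 (p ∷ A)) c) R

ascentBelow-isAscentBelow : ∀ c p w → IsAscentBelow c p (ascentBelow c p w)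
ascentBelow-isAscentBelow c p [] = [-] , [] , tt
ascentBelow-isAscentBelow c p (x ∷ r) with p <? x | x <? c | ascentBelow-isAscentBelow c x r
... | yes p<x | yes x<c | asc , <c , stop rewrite <ᵇ-true p<x | <ᵇ-true x<c = p<x ∷ asc , x<c ∷ <c , stop
... | yes p<x | no x≮c | _ rewrite <ᵇ-true p<x | <ᵇ-false x≮c = [-] , [] , x≮c ∘ proj₂
... | no p≮x | _ | _ rewrite <ᵇ-false p≮x = [-] , [] , p≮x ∘ proj₁

ascentBelow-++ : ∀ {c p} A R → IsAscentBelow c p (A , R) → ascentBelow c p (A ++ R) ≡ (A , R)
ascentBelow-++ [] [] _ = refl
ascentBelow-++ {c} {p} [] (r ∷ R) (_ , _ , stop) with p <? r
... | yes p<r rewrite <ᵇ-true p<r | <ᵇ-false (λ r<c → stop (p<r , r<c)) = refl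
... | no p≮r rewrite <ᵇ-false p≮r = refl
ascentBelow-++ (x ∷ A) R (p<x ∷ asc , x<c ∷ <c , stop)
  rewrite <ᵇ-true p<x | <ᵇ-true x<c | ascentBelow-++ A R (asc , <c , stop) = refl

-- The special wave and the recursion of ψ

data SwSplitCases (w : List ℕ) : Set where
  no-descent : ∀ {A} → incPrefix w ≡ (A , []) → SwSplitCases w
  descent : ∀ {A b post A₁ A₂ D R} → incPrefix w ≡ (A , b ∷ post) → splitLe b A ≡ (A₁ , A₂) →
    decRun (lastOr0 A₁) b post ≡ (D , R) → SwSplitCases w

swSplitCases : ∀ w → SwSplitCases w
swSplitCases w with incPrefix w in e₁
... | A , [] = no-descent e₁
... | A , b ∷ post with splitLe b A in e₂
...   | A₁ , A₂ with decRun (lastOr0 A₁) b post in e₃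
...     | D , R = descent e₁ e₂ e₃

descent-joined : ∀ {w A b post A₁ A₂ D R} → incPrefix w ≡ (A , b ∷ post) → splitLe b A ≡ (A₁ , A₂) →
  decRun (lastOr0 A₁) b post ≡ (D , R) → (A₁ ++ A₂) ++ b ∷ D ++ R ≡ w
descent-joined {w} {A} {b} {post} {A₁} {A₂} {D} {R} e₁ e₂ e₃ = begin
  (A₁ ++ A₂) ++ b ∷ D ++ R  ≡⟨ cong₂ (λ u v → u ++ b ∷ v) (joined-≡ (splitLe-joined b A) e₂)
                                                          (joined-≡ (decRun-joined (lastOr0 A₁) b post) e₃) ⟩
  A ++ b ∷ post             ≡⟨ joined-≡ (incPrefix-joined w) e₁ ⟩
  w                         ∎
  where open ≡-Reasoning

swSplit-no-descent : ∀ w {A} → incPrefix w ≡ (A , []) → swSplit w ≡ (A , [])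
swSplit-no-descent w e rewrite e = refl

swSplit-descent : ∀ w {A b post A₁ A₂ D R} → incPrefix w ≡ (A , b ∷ post) → splitLe b A ≡ (A₁ , A₂) →
  decRun (lastOr0 A₁) b post ≡ (D , R) → swSplit w ≡ (A₂ ++ b ∷ D , A₁ ++ R)
swSplit-descent w e₁ e₂ e₃ rewrite e₁ | e₂ | e₃ = refl

sw-++-swRest : ∀ w → sw w ++ swRest w ↭ w
sw-++-swRest w with swSplitCases w
... | no-descent e₁ = subst (λ p → joined p ↭ w) (sym (swSplit-no-descent w e₁))
  (↭-reflexive (joined-≡ (incPrefix-joined w) e₁))
... | descent {A} {b} {post} {A₁} {A₂} {D} {R} e₁ e₂ e₃ =
  subst (λ p → joined p ↭ w) (sym (swSplit-descent w e₁ e₂ e₃)) (begin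
    (A₂ ++ b ∷ D) ++ A₁ ++ R   ↭⟨ shifts (A₂ ++ b ∷ D) A₁ ⟩
    A₁ ++ (A₂ ++ b ∷ D) ++ R   ≡⟨ cong (A₁ ++_) (++-assoc A₂ (b ∷ D) R) ⟩
    A₁ ++ A₂ ++ b ∷ D ++ R     ≡⟨ ++-assoc A₁ A₂ _ ⟨
    (A₁ ++ A₂) ++ b ∷ D ++ R   ≡⟨ descent-joined e₁ e₂ e₃ ⟩
    w                          ∎)
  where open PermutationReasoning

sw-nonempty : ∀ x w → 0 < length (sw (x ∷ w))
sw-nonempty x w with swSplitCases (x ∷ w) | incPrefix-head x w
... | no-descent e₁ | _ , e rewrite e₁ = subst (λ xs → 0 < length xs) (sym e) (s≤s z≤n)
... | descent {A₂ = A₂} e₁ e₂ e₃ | _ rewrite e₁ | e₂ | e₃ =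
  subst (0 <_) (sym (length-++ A₂)) (≤-trans (s≤s z≤n) (m≤n+m _ (length A₂)))

swRest-shorter : ∀ x w → length (swRest (x ∷ w)) ≤ length w
swRest-shorter x w = ≤-pred (begin-strict
  length (swRest (x ∷ w))                            <⟨ m<n+m _ (sw-nonempty x w) ⟩
  length (sw (x ∷ w)) + length (swRest (x ∷ w))     ≡⟨ length-++ (sw (x ∷ w)) ⟨
  length (sw (x ∷ w) ++ swRest (x ∷ w))             ≡⟨ ↭-length (sw-++-swRest (x ∷ w)) ⟩
  length (x ∷ w)                                     ∎)
  where open ≤-Reasoning

psiFuel-irrelevant : ∀ f g w → length w ≤ f → length w ≤ g → psiFuel f w ≡ psiFuel g w
psiFuel-irrelevant zero zero w _ _ = refl
psiFuel-irrelevant zero (suc g) [] _ _ = refl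
psiFuel-irrelevant (suc f) zero [] _ _ = refl
psiFuel-irrelevant (suc f) (suc g) [] _ _ = refl
psiFuel-irrelevant (suc f) (suc g) (x ∷ w) (s≤s w≤f) (s≤s w≤g) =
  cong (_++ δ (sw (x ∷ w)))
    (psiFuel-irrelevant f g _ (≤-trans (swRest-shorter x w) w≤f) (≤-trans (swRest-shorter x w) w≤g))

ψ-∷ : ∀ x w → ψ (x ∷ w) ≡ ψ (swRest (x ∷ w)) ++ δ (sw (x ∷ w))
ψ-∷ x w = cong (_++ δ (sw (x ∷ w))) (psiFuel-irrelevant (length w) _ _ (swRest-shorter x w) ≤-refl)

ψ-unfold : ∀ {w} → w ≢ [] → ψ w ≡ ψ (swRest w) ++ δ (sw w)
ψ-unfold {[]} w≢[] = ⊥-elim (w≢[] refl)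
ψ-unfold {x ∷ w} _ = ψ-∷ x w

δ-↭ : ∀ u → δ u ↭ u
δ-↭ u with drop (des u) (sort u) in e
... | [] = sort-↭ u
... | x ∷ rest = begin
  x ∷ take (des u) (sort u) ++ rest      ↭⟨ shift x (take (des u) (sort u)) rest ⟨
  take (des u) (sort u) ++ x ∷ rest      ≡⟨ cong (take (des u) (sort u) ++_) e ⟨
  take (des u) (sort u) ++ drop (des u) (sort u) ≡⟨ take++drop≡id (des u) (sort u) ⟩
  sort u                                 ↭⟨ sort-↭ u ⟩
  u                                      ∎
  where open PermutationReasoning

psiFuel-↭ : ∀ f w → length w ≤ f → psiFuel f w ↭ w
psiFuel-↭ zero [] _ = ↭-refl
psiFuel-↭ (suc f) [] _ = ↭-refl
psiFuel-↭ (suc f) (x ∷ w) (s≤s w≤f) = begin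
  psiFuel f (swRest (x ∷ w)) ++ δ (sw (x ∷ w))
    ↭⟨ ++⁺ (psiFuel-↭ f _ (≤-trans (swRest-shorter x w) w≤f)) (δ-↭ _) ⟩
  swRest (x ∷ w) ++ sw (x ∷ w)                 ↭⟨ ++-comm (swRest (x ∷ w)) _ ⟩
  sw (x ∷ w) ++ swRest (x ∷ w)                 ↭⟨ sw-++-swRest (x ∷ w) ⟩
  x ∷ w                                        ∎
  where open PermutationReasoning

ψ-↭ : ∀ w → ψ w ↭ w
ψ-↭ w = psiFuel-↭ (length w) w ≤-refl

drop-length-++ : ∀ (xs ys : List ℕ) → drop (length xs) (xs ++ ys) ≡ ys
drop-length-++ [] ys = refl
drop-length-++ (x ∷ xs) ys = drop-length-++ xs ys

take-length-++ : ∀ (xs ys : List ℕ) → take (length xs) (xs ++ ys) ≡ xs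
take-length-++ [] ys = refl
take-length-++ (x ∷ xs) ys = cong (x ∷_) (take-length-++ xs ys)

δ-≡ : ∀ u X c Y → sort u ≡ X ++ c ∷ Y → des u ≡ length X → δ u ≡ c ∷ X ++ Y
δ-≡ u X c Y sort≡ des≡ =
  trans (unfold des≡ sort≡ (drop-length-++ X (c ∷ Y))) (cong (λ t → c ∷ t ++ Y) (take-length-++ X (c ∷ Y)))
  where
  unfold : ∀ {d s} → des u ≡ d → sort u ≡ s → drop d s ≡ c ∷ Y → δ u ≡ c ∷ take d s ++ Y
  unfold refl refl e rewrite e = refl

δ-ascending : ∀ {w} → Ascending w → δ w ≡ w
δ-ascending {[]} _ = refl
δ-ascending {x ∷ w} asc = δ-≡ (x ∷ w) [] x w (sort-ascending ↭-refl asc) (des-ascending asc)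

δ-wave : ∀ {q Q b D} → b < q → Ascending (q ∷ Q) → Descending (b ∷ D) →
  δ ((q ∷ Q) ++ b ∷ D) ≡ q ∷ reverse (b ∷ D) ++ Q
δ-wave {q} {Q} {b} {D} b<q asc desc = δ-≡ ((q ∷ Q) ++ b ∷ D) (reverse (b ∷ D)) q Q sort≡ des≡
  where
  sort≡ : sort ((q ∷ Q) ++ b ∷ D) ≡ reverse (b ∷ D) ++ q ∷ Q
  sort≡ = sort-ascending
    (↭-trans (++-comm (q ∷ Q) (b ∷ D)) (++⁺ʳ (q ∷ Q) (↭-sym (↭-reverse (b ∷ D)))))
    (ascending-reverse-++ b<q asc desc)
  des≡ : des ((q ∷ Q) ++ b ∷ D) ≡ length (reverse (b ∷ D))
  des≡ = trans (des-wave b<q asc desc) (sym (length-reverse (b ∷ D)))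

ψ-ascending : ∀ {w} → Ascending w → ψ w ≡ w
ψ-ascending {[]} _ = refl
ψ-ascending {x ∷ w} asc = begin
  ψ (x ∷ w)                                ≡⟨ ψ-∷ x w ⟩
  ψ (swRest (x ∷ w)) ++ δ (sw (x ∷ w))
    ≡⟨ cong (λ p → ψ (proj₂ p) ++ δ (proj₁ p)) (swSplit-no-descent (x ∷ w) incPrefix≡) ⟩
  δ (x ∷ w)                                ≡⟨ δ-ascending asc ⟩
  x ∷ w                                    ∎
  where
  open ≡-Reasoning
  incPrefix≡ : incPrefix (x ∷ w) ≡ (x ∷ w , [])
  incPrefix≡ = subst (λ v → incPrefix v ≡ (x ∷ w , [])) (++-identityʳ (x ∷ w)) (incPrefix-++ [] asc (λ ()) tt)

-- Hook factorization

decPrefix-length : ∀ r {D x R} → decPrefix r ≡ (D , x ∷ R) → length R < length r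
decPrefix-length r {D} {x} {R} e = begin-strict
  length R                 <⟨ m<n+m (length R) (s≤s z≤n) ⟩
  suc (length R)           ≤⟨ m≤n+m _ (length D) ⟩
  length D + length (x ∷ R) ≡⟨ length-++ D ⟨
  length (D ++ x ∷ R)      ≡⟨ cong length (joined-≡ (decPrefix-joined r) e) ⟩
  length r                 ∎
  where open ≤-Reasoning

hookRev-irrelevant : ∀ f g r → length r ≤ f → length r ≤ g → hookRev f r ≡ hookRev g r
hookRev-irrelevant zero zero r _ _ = refl
hookRev-irrelevant zero (suc g) [] _ _ = refl
hookRev-irrelevant (suc f) zero [] _ _ = refl
hookRev-irrelevant (suc f) (suc g) r r≤f r≤g with decPrefix r in e
... | D , [] = refl
... | D , x ∷ R rewrite hookRev-irrelevant f g R (≤-pred (≤-trans (decPrefix-length r e) r≤f))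
                                                  (≤-pred (≤-trans (decPrefix-length r e) r≤g)) = refl

hooks : List ℕ → List (List ℕ)
hooks w = proj₂ (hookFactorization w)

IsHook : List ℕ → Set
IsHook (a ∷ a′ ∷ as) = a′ < a × Ascending (a′ ∷ as)
IsHook _ = ⊥

hooks-ascending : ∀ {w} → Ascending w → hooks w ≡ []
hooks-ascending {[]} _ = refl
hooks-ascending {x ∷ w} asc rewrite decPrefix-descending (reverse-linked asc) = refl

hookRev-suc : ∀ f r {D x R} → decPrefix r ≡ (D , x ∷ R) →
  proj₂ (hookRev (suc f) r) ≡ proj₂ (hookRev f R) ++ [ x ∷ reverse D ]
hookRev-suc f r e rewrite e = refl

hooks-++-hook : ∀ Y {h} → IsHook h → hooks (Y ++ h) ≡ hooks Y ++ [ h ]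
hooks-++-hook Y {q ∷ l ∷ L} (l<q , asc) = begin
  proj₂ (hookRev (length (Y ++ h)) (reverse (Y ++ h)))
    ≡⟨ cong₂ (λ f r → proj₂ (hookRev f r)) length≡ reverse≡ ⟩
  proj₂ (hookRev (suc n) (rL ++ q ∷ reverse Y))
    ≡⟨ hookRev-suc n (rL ++ q ∷ reverse Y) decPrefix≡ ⟩
  proj₂ (hookRev n (reverse Y)) ++ [ q ∷ reverse rL ]
    ≡⟨ cong₂ (λ H L′ → proj₂ H ++ [ q ∷ L′ ]) fuel≡ (reverse-involutive (l ∷ L)) ⟩
  hooks Y ++ [ h ] ∎
  where
  open ≡-Reasoning
  h = q ∷ l ∷ L
  rL = reverse (l ∷ L)
  n = length Y + length (l ∷ L)
  length≡ : length (Y ++ h) ≡ suc n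
  length≡ = trans (length-++ Y) (+-suc (length Y) (length (l ∷ L)))
  reverse≡ : reverse (Y ++ h) ≡ rL ++ q ∷ reverse Y
  reverse≡ = trans (reverse-++ Y h) (trans (cong (_++ reverse Y) (unfold-reverse q (l ∷ L)))
                                            (++-assoc rL [ q ] (reverse Y)))
  decPrefix≡ : decPrefix (rL ++ q ∷ reverse Y) ≡ (rL , q ∷ reverse Y)
  decPrefix≡ = decPrefix-++ (q ∷ reverse Y) (reverse-linked asc)
    (++-∷≢[] (reverse L) ∘ trans (sym (unfold-reverse l L)))
    (λ q<l → <-asym l<q (subst (q <_) (lastOr0-reverse l L) q<l))
  fuel≡ : hookRev n (reverse Y) ≡ hookRev (length Y) (reverse Y)
  fuel≡ = hookRev-irrelevant n (length Y) (reverse Y)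
    (subst (_≤ n) (sym (length-reverse Y)) (m≤m+n _ _)) (≤-reflexive (length-reverse Y))

lec-ascending : ∀ {w} → Ascending w → lec w ≡ 0
lec-ascending asc rewrite hooks-ascending asc = refl

lec-++-hook : ∀ Y {h} → IsHook h → lec (Y ++ h) ≡ lec Y + inv h
lec-++-hook Y {h} hook rewrite hooks-++-hook Y hook | map-++ inv (hooks Y) [ h ] | sum-++ (map inv (hooks Y)) [ inv h ] =
  cong (lec Y +_) (+-identityʳ (inv h))

inv-hook : ∀ {q X Q} → All (_< q) X → All (q <_) Q → Ascending (X ++ Q) → inv (q ∷ X ++ Q) ≡ length X
inv-hook {q} {X} {Q} X<q q<Q asc = begin
  countLess q (X ++ Q) + inv (X ++ Q)       ≡⟨ cong₂ _+_ (countLess-++ q X Q) (inv-ascending asc) ⟩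
  countLess q X + countLess q Q + 0
    ≡⟨ cong₂ (λ m n → m + n + 0) (countLess-below X<q) (countLess-above q<Q) ⟩
  length X + 0 + 0                          ≡⟨ trans (+-identityʳ _) (+-identityʳ _) ⟩
  length X                                  ∎
  where open ≡-Reasoning

isHook : ∀ {q} X {Q} → X ≢ [] → All (_< q) X → Ascending (X ++ Q) → IsHook (q ∷ X ++ Q)
isHook [] X≢[] _ _ = ⊥-elim (X≢[] refl)
isHook (x ∷ X) _ (x<q ∷ _) asc = x<q , asc

-- Wave decompositions

-- In the notation of the special wave: A = w₁ ⋯ w_{r-1}, q Q = w_r ⋯ w_t, b = w_{t+1},
-- b D = w_{t+1} ⋯ w_s and R = w_{s+1} ⋯ w_ℓ.
record IsWaveSplit (A : List ℕ) (q : ℕ) (Q : List ℕ) (b : ℕ) (D R : List ℕ) : Set where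
  field
    A-q-Q-asc : Ascending (A ++ q ∷ Q)
    A<b : All (_< b) A
    lastA<b : lastOr0 A < b
    b<q : b < q
    b-D-desc : Descending (b ∷ D)
    lastA<D : All (lastOr0 A <_) D
    R-outside : OnHead (¬_ ∘ Between (lastOr0 A) (lastOr0 (b ∷ D))) R

  q-Q-asc : Ascending (q ∷ Q)
  q-Q-asc = ascending-++⁻ʳ A A-q-Q-asc

  lastA<q : lastOr0 A < q
  lastA<q = <-trans lastA<b b<q

  b<lastQ : b < lastOr0 (q ∷ Q)
  b<lastQ = <-≤-trans b<q (All.head (ascending⇒≤last q-Q-asc))

  lastA<lastD : lastOr0 A < lastOr0 (b ∷ D)
  lastA<lastD = last-all (lastA<b ∷ lastA<D)

module _ {A q Q b D R} (split : IsWaveSplit A q Q b D R) where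
  open IsWaveSplit split

  swSplit-waveSplit : swSplit (A ++ (q ∷ Q) ++ b ∷ D ++ R) ≡ ((q ∷ Q) ++ b ∷ D , A ++ R)
  swSplit-waveSplit = subst (λ w → swSplit w ≡ ((q ∷ Q) ++ b ∷ D , A ++ R)) (++-assoc A (q ∷ Q) (b ∷ D ++ R))
    (swSplit-descent ((A ++ q ∷ Q) ++ b ∷ D ++ R) incPrefix≡
      (splitLe-++ A (q ∷ Q) (All.map <⇒≤ A<b , b<q)) (decRun-++ D R (b-D-desc , lastA<D , R-outside)))
    where
    last≮b : ¬ lastOr0 (A ++ q ∷ Q) < b
    last≮b last<b = <-asym b<lastQ (subst (_< b) (lastOr0-++ A q Q) last<b)
    incPrefix≡ : incPrefix ((A ++ q ∷ Q) ++ b ∷ D ++ R) ≡ (A ++ q ∷ Q , b ∷ D ++ R)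
    incPrefix≡ = incPrefix-++ (b ∷ D ++ R) A-q-Q-asc (++-∷≢[] A) last≮b

  des-waveSplit : OnHead (_≢ lastOr0 A) R → des (A ++ (q ∷ Q) ++ b ∷ D ++ R) ≡ des (A ++ R) + suc (length D)
  des-waveSplit R≢lastA = begin
    des (A ++ (q ∷ Q) ++ b ∷ D ++ R)
      ≡⟨ cong (λ v → des (A ++ v)) (++-assoc (q ∷ Q) (b ∷ D) R) ⟨
    des (A ++ S ++ R)
      ≡⟨ des-++ A (S ++ R) ⟩
    des A + junctionDes A (S ++ R) + des (S ++ R)
      ≡⟨ cong₂ (λ j n → des A + j + n) junction-A-S (des-++ S R) ⟩
    des A + 0 + (des S + junctionDes S R + des R)
      ≡⟨ cong₂ (λ m j → des A + 0 + (m + j + des R)) (des-wave b<q q-Q-asc b-D-desc) junction-S-R ⟩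
    des A + 0 + (suc (length D) + junctionDes A R + des R)
      ≡⟨ solve 4 (λ a d j r → a :+ con 0 :+ (d :+ j :+ r) := a :+ j :+ r :+ d) refl
                 (des A) (suc (length D)) (junctionDes A R) (des R) ⟩
    des A + junctionDes A R + des R + suc (length D)
      ≡⟨ cong (_+ suc (length D)) (des-++ A R) ⟨
    des (A ++ R) + suc (length D) ∎
    where
    open ≡-Reasoning
    S : List ℕ
    S = (q ∷ Q) ++ b ∷ D
    lastS≡ : lastOr0 S ≡ lastOr0 (b ∷ D)
    lastS≡ = lastOr0-++ (q ∷ Q) b D
    junction-A-S : junctionDes A (S ++ R) ≡ 0
    junction-A-S = cong (λ c → if c then 1 else 0) (<ᵇ-false (<⇒≯ lastA<q))
    junction-S-R : junctionDes S R ≡ junctionDes A R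
    junction-S-R = junctionDes-outside R (subst (lastOr0 A <_) (sym lastS≡) lastA<lastD)
      (subst (λ c → OnHead (¬_ ∘ Between (lastOr0 A) c) R) (sym lastS≡) R-outside) R≢lastA

  ascentBelow-waveSplit : All (0 <_) A → ascentBelow (lastOr0 (b ∷ D)) 0 (A ++ R) ≡ (A , R)
  ascentBelow-waveSplit A>0 = ascentBelow-++ A R
    ( ascending-∷ (OnHead-all A>0) A-asc
    , All.map (λ a≤lastA → ≤-<-trans a≤lastA lastA<lastD) (ascending⇒≤last A-asc)
    , subst (λ lo → OnHead (¬_ ∘ Between lo _) R) (sym (lastOr0-0∷ A)) R-outside )
    where
    A-asc : Ascending A
    A-asc = ascending-++⁻ˡ A A-q-Q-asc

  ψ-waveSplit : ψ (A ++ (q ∷ Q) ++ b ∷ D ++ R) ≡ ψ (A ++ R) ++ q ∷ reverse (b ∷ D) ++ Q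
  ψ-waveSplit = begin
    ψ w                                ≡⟨ ψ-unfold (++-∷≢[] A) ⟩
    ψ (swRest w) ++ δ (sw w)           ≡⟨ cong (λ p → ψ (proj₂ p) ++ δ (proj₁ p)) swSplit-waveSplit ⟩
    ψ (A ++ R) ++ δ ((q ∷ Q) ++ b ∷ D) ≡⟨ cong (ψ (A ++ R) ++_) (δ-wave b<q q-Q-asc b-D-desc) ⟩
    ψ (A ++ R) ++ q ∷ reverse (b ∷ D) ++ Q ∎
    where
    open ≡-Reasoning
    w : List ℕ
    w = A ++ (q ∷ Q) ++ b ∷ D ++ R

isWaveSplit-of-ascentBelow : ∀ {A q Q b D R} → b < q → Ascending (q ∷ Q) → Descending (b ∷ D) →
  0 < lastOr0 (b ∷ D) → IsAscentBelow (lastOr0 (b ∷ D)) 0 (A , R) → IsWaveSplit A q Q b D R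
isWaveSplit-of-ascentBelow {A} {q} {Q} {b} {D} {R} b<q q-Q-asc b-D-desc c>0 (0-A-asc , A<c , R-outside) = record
  { A-q-Q-asc = ascending-++⁺ (Linked.tail 0-A-asc) q-Q-asc (<-trans lastA<b b<q)
  ; A<b = All.map (λ a<c → <-≤-trans a<c c≤b) A<c
  ; lastA<b = lastA<b
  ; b<q = b<q
  ; b-D-desc = b-D-desc
  ; lastA<D = All.map (<-≤-trans lastA<c) (All.tail c≤b-D)
  ; R-outside = subst (λ lo → OnHead (¬_ ∘ Between lo _) R) (lastOr0-0∷ A) R-outside
  }
  where
  c≤b-D : All (lastOr0 (b ∷ D) ≤_) (b ∷ D)
  c≤b-D = descending⇒last≤ b-D-desc
  c≤b : lastOr0 (b ∷ D) ≤ b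
  c≤b = All.head c≤b-D
  lastA<c : lastOr0 A < lastOr0 (b ∷ D)
  lastA<c = lastOr0-all A<c c>0
  lastA<b : lastOr0 A < b
  lastA<b = <-≤-trans lastA<c c≤b

record Wave (w : List ℕ) : Set where
  field
    A : List ℕ
    q : ℕ
    Q : List ℕ
    b : ℕ
    D : List ℕ
    R : List ℕ
    isWaveSplit : IsWaveSplit A q Q b D R
    w≡ : w ≡ A ++ (q ∷ Q) ++ b ∷ D ++ R

wave-of-scan : ∀ {w A₁ A₂ b D R} → InW w → (A₁ ++ A₂) ++ b ∷ D ++ R ≡ w → Ascending (A₁ ++ A₂) →
  ¬ lastOr0 (A₁ ++ A₂) < b → IsSplitLe b (A₁ , A₂) → IsDecRun (lastOr0 A₁) b (D , R) → Wave w
wave-of-scan {w} {A₁} {A₂} {b} {D} {R} (w>0 , w-unique) w≡ asc last≮b (A₁≤b , b<A₂) (b-D-desc , lastA₁<D , R-out) =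
  go A₂ b<A₂ asc last≮b w≡
  where
  A₁<b : All (_< b) A₁
  A₁<b = All.zipWith (λ (a≤b , b≢a) → ≤∧≢⇒< a≤b (b≢a ∘ sym)) (A₁≤b , b∉A₁)
    where
    b∉A₁ : All (b ≢_) A₁
    b∉A₁ = All.++⁻ˡ A₁ (All.++⁻ˡ (A₁ ++ A₂) (unique-mid (A₁ ++ A₂) (subst Unique (sym w≡) w-unique)))
  lastA₁<b : lastOr0 A₁ < b
  lastA₁<b = lastOr0-all A₁<b (All.head (All.++⁻ʳ (A₁ ++ A₂) (subst (All (0 <_)) (sym w≡) w>0)))
  go : ∀ A₂ → OnHead (b <_) A₂ → Ascending (A₁ ++ A₂) → ¬ lastOr0 (A₁ ++ A₂) < b →
       (A₁ ++ A₂) ++ b ∷ D ++ R ≡ w → Wave w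
  go [] _ _ last≮b _ = ⊥-elim (last≮b (subst (_< b) (cong lastOr0 (sym (++-identityʳ A₁))) lastA₁<b))
  go (q ∷ Q) b<q asc _ w≡ = record
    { A = A₁ ; q = q ; Q = Q ; b = b ; D = D ; R = R
    ; isWaveSplit = record
      { A-q-Q-asc = asc ; A<b = A₁<b ; lastA<b = lastA₁<b ; b<q = b<q
      ; b-D-desc = b-D-desc ; lastA<D = lastA₁<D ; R-outside = R-out }
    ; w≡ = trans (sym w≡) (++-assoc A₁ (q ∷ Q) _) }

ascending-or-wave : ∀ w → InW w → Ascending w ⊎ Wave w
ascending-or-wave [] _ = inj₁ []
ascending-or-wave (x ∷ w) w∈W with swSplitCases (x ∷ w)
... | no-descent e₁ = inj₁ (subst Ascending (trans (sym (++-identityʳ _)) (joined-≡ (incPrefix-joined (x ∷ w)) e₁))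
                                           (proj₁ (subst IsIncPrefix e₁ (incPrefix-isIncPrefix (x ∷ w)))))
... | descent {A} {b} {post} {A₁} e₁ e₂ e₃
  with subst IsIncPrefix e₁ (incPrefix-isIncPrefix (x ∷ w)) | joined-≡ (splitLe-joined b A) e₂
...   | asc , last≮b | refl = inj₂ (wave-of-scan w∈W (descent-joined e₁ e₂ e₃) asc last≮b
          (subst (IsSplitLe b) e₂ (splitLe-isSplitLe b A))
          (subst (IsDecRun (lastOr0 A₁) b) e₃ (decRun-isDecRun _ b post)))

-- Rebuilds w from w ∖ sw(w) and the hook δ(sw w) (insertWave-hook); the two fall-through
-- cases never occur for a hook.
insertWave : List ℕ → List ℕ → List ℕ
insertWave v [] = v
insertWave v (q ∷ L) with splitLe q L
... | X , Q with reverse X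
...   | [] = v
...   | b ∷ D with ascentBelow (lastOr0 (b ∷ D)) 0 v
...     | A , R = A ++ (q ∷ Q) ++ b ∷ D ++ R

module WaveFacts {w} (wave : Wave w) (w∈W : InW w) where
  open Wave wave public
  open IsWaveSplit isWaveSplit public

  S : List ℕ
  S = (q ∷ Q) ++ b ∷ D

  w∖sw : List ℕ
  w∖sw = A ++ R

  X : List ℕ
  X = reverse (b ∷ D)

  hook : List ℕ
  hook = q ∷ X ++ Q

  swSplit≡ : swSplit w ≡ (S , w∖sw)
  swSplit≡ = trans (cong swSplit w≡) (swSplit-waveSplit isWaveSplit)

  X-q-Q-asc : Ascending (X ++ q ∷ Q)
  X-q-Q-asc = ascending-reverse-++ b<q q-Q-asc b-D-desc

  X<q : All (_< q) X
  X<q = ascending-++⁻-mid X X-q-Q-asc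

  X-Q-asc : Ascending (X ++ Q)
  X-Q-asc = ascending-remove X X-q-Q-asc

  X≢[] : X ≢ []
  X≢[] = ++-∷≢[] (reverse D) ∘ trans (sym (unfold-reverse b D))

  hook-isHook : IsHook hook
  hook-isHook = isHook X X≢[] X<q X-Q-asc

  inv-hook≡ : inv hook ≡ suc (length D)
  inv-hook≡ = trans (inv-hook X<q (ascending⇒head< q-Q-asc) X-Q-asc) (length-reverse (b ∷ D))

  ψ≡ : ψ w ≡ ψ w∖sw ++ hook
  ψ≡ = trans (cong ψ w≡) (ψ-waveSplit isWaveSplit)

  S++w∖sw↭w : S ++ w∖sw ↭ w
  S++w∖sw↭w = subst (λ p → joined p ↭ w) swSplit≡ (sw-++-swRest w)

  w∖sw∈W : InW w∖sw
  w∖sw∈W = InW-++⁻ʳ S (InW-resp-↭ (↭-sym S++w∖sw↭w) w∈W)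

  w∖sw-shorter : length w∖sw < length w
  w∖sw-shorter = begin-strict
    length w∖sw             <⟨ m<n+m (length w∖sw) (s≤s z≤n) ⟩
    length S + length w∖sw  ≡⟨ length-++ S ⟨
    length (S ++ w∖sw)      ≡⟨ ↭-length S++w∖sw↭w ⟩
    length w                ∎
    where open ≤-Reasoning

  A>0 : All (0 <_) A
  A>0 = All.++⁻ˡ A (subst (All (0 <_)) w≡ (proj₁ w∈W))

  R≢lastA : OnHead (_≢ lastOr0 A) R
  R≢lastA = go R (subst InW w≡′ w∈W)
    where
    w≡′ : w ≡ (A ++ S) ++ R
    w≡′ = trans w≡ (trans (cong (A ++_) (sym (++-assoc (q ∷ Q) (b ∷ D) R))) (sym (++-assoc A S R)))
    go : ∀ R′ → InW ((A ++ S) ++ R′) → OnHead (_≢ lastOr0 A) R′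
    go [] _ = tt
    go (r ∷ R′) (pos , uniq) = lastOr0-all (All.++⁻ˡ A (All.++⁻ˡ (A ++ S) (unique-mid (A ++ S) uniq)))
      (<⇒≢ (All.head (All.++⁻ʳ (A ++ S) pos)) ∘ sym)

  des≡ : des w ≡ des w∖sw + suc (length D)
  des≡ = trans (cong des w≡) (des-waveSplit isWaveSplit R≢lastA)

  ascentBelow≡ : ascentBelow (lastOr0 (b ∷ D)) 0 w∖sw ≡ (A , R)
  ascentBelow≡ = ascentBelow-waveSplit isWaveSplit A>0

  des-positive : 0 < des w
  des-positive = subst (0 <_) (sym des≡) (≤-trans (s≤s z≤n) (m≤n+m _ (des w∖sw)))

  insertWave-hook : insertWave w∖sw hook ≡ w
  insertWave-hook rewrite splitLe-++ X Q (All.map <⇒≤ X<q , OnHead-all (ascending⇒head< q-Q-asc))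
    | reverse-involutive (b ∷ D) | ascentBelow≡ = sym w≡

des≡lec∘ψ-acc : ∀ w → Acc _<_ (length w) → InW w → des w ≡ lec (ψ w)
des≡lec∘ψ-acc w (acc rec) w∈W with ascending-or-wave w w∈W
... | inj₁ asc = trans (des-ascending asc) (sym (trans (cong lec (ψ-ascending asc)) (lec-ascending asc)))
... | inj₂ wave = begin
  des w
    ≡⟨ des≡ ⟩
  des w∖sw + suc (length D)
    ≡⟨ cong₂ _+_ (des≡lec∘ψ-acc w∖sw (rec w∖sw-shorter) w∖sw∈W) (sym inv-hook≡) ⟩
  lec (ψ w∖sw) + inv hook
    ≡⟨ lec-++-hook (ψ w∖sw) hook-isHook ⟨
  lec (ψ w∖sw ++ hook)
    ≡⟨ cong lec ψ≡ ⟨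
  lec (ψ w) ∎
  where
  open ≡-Reasoning
  open WaveFacts wave w∈W

des≡lec∘ψ : ∀ w → InW w → des w ≡ lec (ψ w)
des≡lec∘ψ w = des≡lec∘ψ-acc w (<-wellFounded (length w))

des-resp-ψ : ∀ {u v} → InW u → InW v → ψ u ≡ ψ v → des u ≡ des v
des-resp-ψ {u} {v} u∈W v∈W ψu≡ψv =
  trans (des≡lec∘ψ u u∈W) (trans (cong lec ψu≡ψv) (sym (des≡lec∘ψ v v∈W)))

ψ-ascending≢ψ-wave : ∀ {u v} → Ascending u → Wave v → InW u → InW v → ψ u ≢ ψ v
ψ-ascending≢ψ-wave u-asc v-wave u∈W v∈W ψu≡ψv =
  <⇒≢ (WaveFacts.des-positive v-wave v∈W) (trans (sym (des-ascending u-asc)) (des-resp-ψ u∈W v∈W ψu≡ψv))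

ψ-injective-acc : ∀ u v → Acc _<_ (length u) → InW u → InW v → ψ u ≡ ψ v → u ≡ v
ψ-injective-acc u v (acc rec) u∈W v∈W ψu≡ψv with ascending-or-wave u u∈W | ascending-or-wave v v∈W
... | inj₁ u-asc | inj₁ v-asc = trans (sym (ψ-ascending u-asc)) (trans ψu≡ψv (ψ-ascending v-asc))
... | inj₁ u-asc | inj₂ v-wave = ⊥-elim (ψ-ascending≢ψ-wave u-asc v-wave u∈W v∈W ψu≡ψv)
... | inj₂ u-wave | inj₁ v-asc = ⊥-elim (ψ-ascending≢ψ-wave v-asc u-wave v∈W u∈W (sym ψu≡ψv))
... | inj₂ u-wave | inj₂ v-wave = begin
  u                          ≡⟨ U.insertWave-hook ⟨
  insertWave U.w∖sw U.hook   ≡⟨ cong₂ insertWave w∖sw≡ hook≡ ⟩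
  insertWave V.w∖sw V.hook   ≡⟨ V.insertWave-hook ⟩
  v                          ∎
  where
  open ≡-Reasoning
  module U = WaveFacts u-wave u∈W
  module V = WaveFacts v-wave v∈W
  ψ++≡ : ψ U.w∖sw ++ U.hook ≡ ψ V.w∖sw ++ V.hook
  ψ++≡ = trans (sym U.ψ≡) (trans ψu≡ψv V.ψ≡)
  hooks≡ : hooks (ψ U.w∖sw) ++ [ U.hook ] ≡ hooks (ψ V.w∖sw) ++ [ V.hook ]
  hooks≡ = trans (sym (hooks-++-hook (ψ U.w∖sw) U.hook-isHook))
                 (trans (cong hooks ψ++≡) (hooks-++-hook (ψ V.w∖sw) V.hook-isHook))
  hook≡ : U.hook ≡ V.hook
  hook≡ = proj₂ (∷ʳ-injective _ _ hooks≡)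
  w∖sw≡ : U.w∖sw ≡ V.w∖sw
  w∖sw≡ = ψ-injective-acc U.w∖sw V.w∖sw (rec U.w∖sw-shorter) U.w∖sw∈W V.w∖sw∈W
    (++-cancelʳ U.hook (ψ U.w∖sw) (ψ V.w∖sw) (trans ψ++≡ (cong (ψ V.w∖sw ++_) (sym hook≡))))

ψ-injective : ∀ u v → InW u → InW v → ψ u ≡ ψ v → u ≡ v
ψ-injective u v = ψ-injective-acc u v (<-wellFounded (length u))

ascending-or-hook : ∀ v → Unique v → Ascending v ⊎ ∃₂ λ Y h → IsHook h × v ≡ Y ++ h
ascending-or-hook [] _ = inj₁ []
ascending-or-hook (y ∷ v) (y∉v ∷ v-unique) with ascending-or-hook v v-unique
... | inj₂ (Y , h , hook , v≡) = inj₂ (y ∷ Y , h , hook , cong (y ∷_) v≡)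
... | inj₁ v-asc with v | y∉v | v-asc
...   | [] | _ | _ = inj₁ [-]
...   | z ∷ zs | y≢z ∷ _ | z-zs-asc with y <? z
...     | yes y<z = inj₁ (y<z ∷ z-zs-asc)
...     | no y≮z = inj₂ ([] , y ∷ z ∷ zs , (≤∧≢⇒< (≮⇒≥ y≮z) (y≢z ∘ sym) , z-zs-asc) , refl)

hook-as-wave : ∀ {x L} → IsHook (x ∷ L) → Unique (x ∷ L) →
  ∃₂ λ b D → ∃ λ Q → reverse (b ∷ D) ++ Q ≡ L × b < x × Ascending (x ∷ Q) × Descending (b ∷ D)
hook-as-wave {x} {l ∷ L} (l<x , asc) (x∉L ∷ _)
  with splitLe x (l ∷ L) | splitLe-isSplitLe x (l ∷ L) | splitLe-joined x (l ∷ L)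
... | [] , Q | _ , x<l | refl = ⊥-elim (<-asym l<x x<l)
... | X@(y ∷ Y) , Q | X≤x , x<Q | X++Q≡L
  with reverse X | reverse-involutive X | reverse-linked (ascending-++⁻ˡ X (subst Ascending (sym X++Q≡L) asc))
...   | [] | () | _
...   | b ∷ D | revb-D≡X | b-D-desc =
  b , D , Q , trans (cong (_++ Q) revb-D≡X) X++Q≡L , b<x , x-Q-asc , b-D-desc
  where
  X<x : All (_< x) X
  X<x = All.zipWith (λ (a≤x , x≢a) → ≤∧≢⇒< a≤x (x≢a ∘ sym))
                    (X≤x , All.++⁻ˡ X (subst (All (x ≢_)) (sym X++Q≡L) x∉L))
  b<x : b < x
  b<x = All.head (All-resp-↭ (↭-reverse (b ∷ D)) (subst (All (_< x)) (sym revb-D≡X) X<x))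
  x-Q-asc : Ascending (x ∷ Q)
  x-Q-asc = ascending-∷ x<Q (ascending-++⁻ʳ X (subst Ascending (sym X++Q≡L) asc))

ψ-surjective-acc : ∀ v → Acc _<_ (length v) → InW v → ∃ λ u → InW u × ψ u ≡ v
ψ-surjective-acc v (acc rec) v∈W with ascending-or-hook v (proj₂ v∈W)
... | inj₁ asc = v , v∈W , ψ-ascending asc
... | inj₂ (Y , x ∷ L , hook , refl) with hook-as-wave hook (unique-++⁻ʳ Y (proj₂ v∈W))
...   | b , D , Q , revb-D++Q≡L , b<x , x-Q-asc , b-D-desc
  with ψ-surjective-acc Y (rec (length-<-++-∷ Y)) (InW-++⁻ˡ Y v∈W)
...     | u′ , _ , ψu′≡Y = w , InW-resp-↭ (ψ-↭ w) (subst InW (sym ψw≡v) v∈W) , ψw≡v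
  where
  c>0 : 0 < lastOr0 (b ∷ D)
  c>0 = last-all (All-resp-↭ (↭-reverse (b ∷ D)) (All.++⁻ˡ (reverse (b ∷ D))
          (subst (All (0 <_)) (sym revb-D++Q≡L) (All.tail (All.++⁻ʳ Y (proj₁ v∈W))))))
  A R : List ℕ
  A = proj₁ (ascentBelow (lastOr0 (b ∷ D)) 0 u′)
  R = proj₂ (ascentBelow (lastOr0 (b ∷ D)) 0 u′)
  split : IsWaveSplit A x Q b D R
  split = isWaveSplit-of-ascentBelow b<x x-Q-asc b-D-desc c>0 (ascentBelow-isAscentBelow _ 0 u′)
  w : List ℕ
  w = A ++ (x ∷ Q) ++ b ∷ D ++ R
  ψw≡v : ψ w ≡ Y ++ x ∷ L
  ψw≡v = begin
    ψ w
      ≡⟨ ψ-waveSplit split ⟩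
    ψ (A ++ R) ++ x ∷ reverse (b ∷ D) ++ Q
      ≡⟨ cong₂ (λ u h → ψ u ++ x ∷ h) (ascentBelow-joined _ 0 u′) revb-D++Q≡L ⟩
    ψ u′ ++ x ∷ L
      ≡⟨ cong (_++ x ∷ L) ψu′≡Y ⟩
    Y ++ x ∷ L ∎
    where open ≡-Reasoning

ψ-surjective : ∀ v → InW v → ∃ λ u → InW u × ψ u ≡ v
ψ-surjective v = ψ-surjective-acc v (<-wellFounded (length v))

InW-applyUpTo : ∀ n → InW (applyUpTo suc n)
InW-applyUpTo n =
  All.applyUpTo⁺₂ suc n (λ _ → s≤s z≤n) , Unique.applyUpTo⁺₁ suc n (λ i<j _ → <⇒≢ i<j ∘ suc-injective)

ψ-surjective-on-perms : ∀ n v → v ↭ applyUpTo suc n → ∃ λ u → (u ↭ applyUpTo suc n) × ψ u ≡ v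
ψ-surjective-on-perms n v v↭ with ψ-surjective v (InW-resp-↭ (↭-sym v↭) (InW-applyUpTo n))
... | u , _ , ψu≡v = u , ↭-trans (↭-sym (ψ-↭ u)) (subst (_↭ applyUpTo suc n) (sym ψu≡v) v↭) , ψu≡v

theorem6p11 :
    (∀ x w → InW (x ∷ w) → ψ (x ∷ w) ≡ ψ (swRest (x ∷ w)) ++ δ (sw (x ∷ w)))
    × (∀ w → InW w → InW (ψ w))
    × (∀ u v → InW u → InW v → ψ u ≡ ψ v → u ≡ v)
    × (∀ v → InW v → ∃ λ u → InW u × ψ u ≡ v)
    × (∀ w → InW w → des w ≡ lec (ψ w))
    × (∀ n w → w ↭ applyUpTo suc n → ψ w ↭ applyUpTo suc n)
    × (∀ n v → v ↭ applyUpTo suc n → ∃ λ u → (u ↭ applyUpTo suc n) × ψ u ≡ v)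
theorem6p11 =
    (λ x w _ → ψ-∷ x w)
  , (λ w → InW-resp-↭ (↭-sym (ψ-↭ w)))
  , ψ-injective
  , ψ-surjective
  , des≡lec∘ψ
  , (λ n w w↭ → ↭-trans (ψ-↭ w) w↭)
  , ψ-surjective-on-perms
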